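{- For every integer $s\ge 2$, the number of pairwise non-isomorphic graphs that are isomorphic to $\mathcal{G}(w)$ for some slender word $w$ over $\Sigma_s$ equals the number of partitions of the integer $s$.
   Context: For $s\ge 2$, $\Sigma_s$ denotes the ordered alphabet $\{a_1<a_2<\dots<a_s\}$. A word $w$ over $\Sigma_s$ is slender if $|w|_{a}=1$ for every $a\in\Sigma_s$, i.e. each letter of $\Sigma_s$ occurs exactly once in $w$. For a nonempty word $w=w_1\cdots w_n$ over $\Sigma_s$, the Parikh graph $\mathcal{G}(w)$ is the simple undirected graph with vertex set $\{1,\dots,n\}$ in which, for $1\le i<j\le n$, vertices $i$ and $j$ are adjacent if and only if $w_i=a_k$ and $w_j=a_{k+1}$ for some $1\le k\le s-1$. A partition of $s$ is an unordered multiset of positive integers summing to $s$. -}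

module Defs where

open import Data.Nat using (ℕ; zero; suc; _<_; _≥_)
open import Data.Fin using (Fin; toℕ) renaming (_<_ to _<ᶠ_)
open import Data.Fin.Properties using (_≟_)
open import Data.List using (List; length; filter; lookup)
open import Data.Nat.ListAction using (sum)
open import Data.List.Relation.Unary.All using (All)
open import Data.List.Relation.Unary.Linked using (Linked)
open import Data.Product using (Σ; _×_)
open import Data.Sum using (_⊎_)
open import Function.Bundles using (_↔_; _⇔_; Inverse)
open import Relation.Binary.PropositionalEquality using (_≡_)

-- The ordered alphabet Σ_s = {a_1 < ... < a_s} is modelled by Fin s,
-- the letter a_k being the element of Fin s with toℕ equal to k - 1.
Word : ℕ → Set
Word s = List (Fin s)

occ : ∀ {s} → Fin s → Word s → ℕ
occ a w = length (filter (a ≟_) w)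

IsSlender : ∀ {s} → Word s → Set
IsSlender {s} w = (a : Fin s) → occ a w ≡ 1

SlenderWord : ℕ → Set
SlenderWord s = Σ (Word s) IsSlender

-- simple undirected graphs on vertex set Fin n (vertices 1..n)
record Graph : Set₁ where
  field
    n   : ℕ
    Adj : Fin n → Fin n → Set
open Graph public

NextLetter : ∀ {s} → Fin s → Fin s → Set
NextLetter x y = toℕ y ≡ suc (toℕ x)

ParikhAdj : ∀ {s} (w : Word s) → Fin (length w) → Fin (length w) → Set
ParikhAdj w i j =
  (i <ᶠ j × NextLetter (lookup w i) (lookup w j))
  ⊎ (j <ᶠ i × NextLetter (lookup w j) (lookup w i))

ParikhGraph : ∀ {s} → Word s → Graph
ParikhGraph w = record { n = length w ; Adj = ParikhAdj w }

_≅_ : Graph → Graph → Set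
G ≅ H = Σ (Fin (n G) ↔ Fin (n H)) λ f →
  ∀ i j → Adj G i j ⇔ Adj H (Inverse.to f i) (Inverse.to f j)

-- partitions of s, as multisets represented canonically by
-- non-increasing lists of positive integers summing to s
record Partition (s : ℕ) : Set where
  constructor partition
  field
    parts    : List ℕ
    nonincr  : Linked _≥_ parts
    positive : All (λ k → 0 < k) parts
    sums     : sum parts ≡ s

module Submission where

-- A slender word w lists each letter once, so relabelling each vertex of G(w) by its
-- letter turns G(w) into the path a_1 — a_2 — ⋯ — a_s with the edge a_j — a_{j+1}
-- removed exactly when a_{j+1} occurs before a_j in w (a descent; parikh≃cut).  Any
-- such cut path is a disjoint union of paths whose sizes form a composition of s
-- (decompose); reordering the paths gives an isomorphic graph (Paths-perm), so G(w) is
-- the union of paths sized by a partition of s (classify).  Conversely each composition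
-- is realised by an explicit canonical word (canonical-graph).  The number of vertices
-- lying in components with t vertices is an isomorphism invariant (Mass-invariant) that
-- determines the partition (Mass-injective), and the partitions of s can be listed
-- (partitions-finite).  The theorem enumerates the partitions and takes their canonical
-- words as representatives of the isomorphism classes.

open import Defs
open import Data.Bool using (if_then_else_)
open import Data.Empty using (⊥; ⊥-elim)
open import Data.Nat using (ℕ; zero; suc; _+_; _*_; _≤_; _<_; _≥_; s≤s; z≤n)
import Data.Nat.Properties as ℕ
open import Algebra.Properties.CommutativeMonoid.Sum ℕ.+-0-commutativeMonoid
  using (sum-permute; sum-cong-≗) renaming (sum to ∑)
open import Data.Nat.ListAction using (sum)
open import Data.Nat.ListAction.Properties using (sum-↭)
open import Data.Fin using (Fin; toℕ; zero; suc; _↑ˡ_; _↑ʳ_; fromℕ; fromℕ<; splitAt; join) renaming (_<_ to _<ᶠ_)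
open import Data.Fin.Properties using (_≟_; toℕ-injective; any?; <-cmp; <⇒≢; toℕ-↑ˡ; toℕ-↑ʳ; toℕ<n; ↑ˡ-injective; ↑ʳ-injective; +↔⊎; splitAt-↑ˡ; splitAt-↑ʳ; join-splitAt; toℕ-fromℕ; toℕ-fromℕ<)
open import Data.List using (List; []; _∷_; length; lookup; map; _++_; upTo; cartesianProductWith; deduplicate)
import Data.List.Properties as List
open import Data.List.Membership.Propositional using (_∈_; _∉_)
open import Data.List.Membership.Propositional.Properties using (∈-lookup; ∈-map⁺; ∈-map⁻; ∈-++⁺ˡ; ∈-++⁺ʳ; ∈-++⁻; ∈-cartesianProductWith⁺; ∈-upTo⁺; ∈-deduplicate⁺)
open import Data.List.Relation.Unary.Any using (here; there; index)
import Data.List.Relation.Unary.Any as Any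
open import Data.List.Relation.Unary.Any.Properties using (lookup-index)
open import Data.List.Relation.Unary.All using (All; []; _∷_)
import Data.List.Relation.Unary.All as All
import Data.List.Relation.Unary.All.Properties as All
open import Data.List.Relation.Unary.All.Properties using (¬Any⇒All¬)
open import Data.List.Relation.Unary.AllPairs using (AllPairs; []; _∷_)
import Data.List.Relation.Unary.AllPairs as AllPairs
import Data.List.Relation.Unary.AllPairs.Properties as AllPairs
open import Data.List.Relation.Unary.Linked using (Linked; []; [-]; _∷_)
import Data.List.Relation.Unary.Linked as Linked
open import Data.List.Relation.Unary.Linked.Properties using (Linked⇒All)
open import Data.List.Relation.Unary.Unique.Propositional using (Unique)
import Data.List.Relation.Unary.Unique.Propositional.Properties as Unique
open import Data.List.Relation.Unary.Unique.DecPropositional.Properties using (deduplicate-!)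
open import Data.List.Relation.Binary.Permutation.Propositional as ↭ using (_↭_; ↭-sym)
open import Data.List.Relation.Binary.Permutation.Propositional.Properties using (All-resp-↭)
import Data.List.Sort
open import Data.Product using (Σ; _×_; ∃; _,_; proj₁; proj₂)
open import Data.Sum using (_⊎_; inj₁; inj₂)
open import Data.Sum.Algebra using (⊎-comm; ⊎-assoc)
open import Data.Sum.Function.Propositional using (_⊎-↔_)
open import Function using (_∘_)
open import Function.Bundles using (_↔_; _⇔_; Inverse; Injection; Equivalence; mk↔ₛ′; mk⇔)
open import Function.Properties.Inverse using (↔-refl; ↔-sym; ↔-trans; ↔⇒↣)
import Function.Properties.Equivalence as ⇔
open import Level using (0ℓ)
open import Relation.Nullary using (¬_; Dec; yes; no; does)
open import Relation.Nullary.Decidable using (_×-dec_; _⊎-dec_; map′)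
open import Relation.Unary using (Decidable)
open import Relation.Binary using (DecidableEquality; tri<; tri≈; tri>)
open import Relation.Binary.Construct.Closure.ReflexiveTransitive using (Star; ε; _◅_; _◅◅_; gmap; reverse)
import Relation.Binary.Construct.Flip.EqAndOrd as Flip
open import Relation.Binary.PropositionalEquality
  using (_≡_; refl; sym; trans; cong; cong₂; subst; subst₂; module ≡-Reasoning)

record VGraph : Set₁ where
  constructor graph
  field
    Vertex : Set
    Edge   : Vertex → Vertex → Set
open VGraph public

asVGraph : Graph → VGraph
asVGraph G = graph (Fin (n G)) (Adj G)

record _≃_ (G H : VGraph) : Set where
  constructor _,_
  field
    bij   : Vertex G ↔ Vertex H
    edges : ∀ x y → Edge G x y ⇔ Edge H (Inverse.to bij x) (Inverse.to bij y)

≅⇒≃ : ∀ {G H} → G ≅ H → asVGraph G ≃ asVGraph H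
≅⇒≃ (f , edges) = f , edges

≃⇒≅ : ∀ {G H} → asVGraph G ≃ asVGraph H → G ≅ H
≃⇒≅ (f , edges) = f , edges

≃-refl : ∀ {G} → G ≃ G
≃-refl = ↔-refl , λ _ _ → ⇔.refl

≃-sym : ∀ {G H} → G ≃ H → H ≃ G
≃-sym {G} {H} (f , adj) = ↔-sym f , λ x y →
  ⇔.sym (subst₂ (λ u v → Edge G (from x) (from y) ⇔ Edge H u v)
          (Inverse.strictlyInverseˡ f x) (Inverse.strictlyInverseˡ f y)
          (adj (from x) (from y)))
  where from = Inverse.from f

≃-trans : ∀ {G H K} → G ≃ H → H ≃ K → G ≃ K
≃-trans (f , p) (g , q) = ↔-trans f g , λ x y → ⇔.trans (p x y) (q _ _)

_⊕_ : VGraph → VGraph → VGraph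
G ⊕ H = graph (Vertex G ⊎ Vertex H) edge
  where
  edge : Vertex G ⊎ Vertex H → Vertex G ⊎ Vertex H → Set
  edge (inj₁ x) (inj₁ y) = Edge G x y
  edge (inj₂ x) (inj₂ y) = Edge H x y
  edge _        _        = ⊥

⊕-cong : ∀ {G G′ H H′} → G ≃ G′ → H ≃ H′ → (G ⊕ H) ≃ (G′ ⊕ H′)
⊕-cong (f , p) (g , q) = (f ⊎-↔ g) , λ
  { (inj₁ x) (inj₁ y) → p x y
  ; (inj₁ x) (inj₂ y) → ⇔.refl
  ; (inj₂ x) (inj₁ y) → ⇔.refl
  ; (inj₂ x) (inj₂ y) → q x y }

⊕-comm : ∀ {G H} → (G ⊕ H) ≃ (H ⊕ G)
⊕-comm {G} {H} = ⊎-comm (Vertex G) (Vertex H) , λ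
  { (inj₁ x) (inj₁ y) → ⇔.refl
  ; (inj₁ x) (inj₂ y) → ⇔.refl
  ; (inj₂ x) (inj₁ y) → ⇔.refl
  ; (inj₂ x) (inj₂ y) → ⇔.refl }

⊕-assoc : ∀ {G H K} → ((G ⊕ H) ⊕ K) ≃ (G ⊕ (H ⊕ K))
⊕-assoc {G} {H} {K} = ⊎-assoc 0ℓ (Vertex G) (Vertex H) (Vertex K) , λ
  { (inj₁ (inj₁ x)) (inj₁ (inj₁ y)) → ⇔.refl
  ; (inj₁ (inj₁ x)) (inj₁ (inj₂ y)) → ⇔.refl
  ; (inj₁ (inj₁ x)) (inj₂ y)        → ⇔.refl
  ; (inj₁ (inj₂ x)) (inj₁ (inj₁ y)) → ⇔.refl
  ; (inj₁ (inj₂ x)) (inj₁ (inj₂ y)) → ⇔.refl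
  ; (inj₁ (inj₂ x)) (inj₂ y)        → ⇔.refl
  ; (inj₂ x)        (inj₁ (inj₁ y)) → ⇔.refl
  ; (inj₂ x)        (inj₁ (inj₂ y)) → ⇔.refl
  ; (inj₂ x)        (inj₂ y)        → ⇔.refl }

data Joined (B : ℕ → Set) : ℕ → ℕ → Set where
  up   : ∀ {x y} → y ≡ suc x → ¬ B y → Joined B x y
  down : ∀ {x y} → x ≡ suc y → ¬ B x → Joined B x y

Joined-sym : ∀ {B x y} → Joined B x y → Joined B y x
Joined-sym (up e ¬b)   = down e ¬b
Joined-sym (down e ¬b) = up e ¬b

Cut : ℕ → (ℕ → Set) → VGraph
Cut n B = graph (Fin n) λ u v → Joined B (toℕ u) (toℕ v)

Path : ℕ → VGraph
Path n = Cut n (λ _ → ⊥)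

Paths : List ℕ → VGraph
Paths []       = Path 0
Paths (r ∷ rs) = Path r ⊕ Paths rs

cut-cong : ∀ {n} {B B′ : ℕ → Set} → (∀ x → suc x < n → B (suc x) ⇔ B′ (suc x)) → Cut n B ≃ Cut n B′
cut-cong {n} same = ↔-refl , λ u v →
  mk⇔ (transfer (λ x lt → Equivalence.from (same x lt)) (toℕ<n u) (toℕ<n v))
      (transfer (λ x lt → Equivalence.to (same x lt)) (toℕ<n u) (toℕ<n v))
  where
  transfer : ∀ {C C′ : ℕ → Set} → (∀ x → suc x < n → C′ (suc x) → C (suc x)) →
    ∀ {x y} → x < n → y < n → Joined C x y → Joined C′ x y
  transfer back x<n y<n (up refl ¬c) = up refl (λ c′ → ¬c (back _ y<n c′))
  transfer back x<n y<n (down refl ¬c) = down refl (λ c′ → ¬c (back _ x<n c′))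

uncut⇒path : ∀ {n B} → (∀ x → suc x < n → ¬ B (suc x)) → Cut n B ≃ Path n
uncut⇒path uncut = cut-cong λ x lt → mk⇔ (uncut x lt) ⊥-elim

shift : ℕ → (ℕ → Set) → ℕ → Set
shift r B j = B (r + j)

+-consecutive : ∀ r {u v} → (r + v ≡ suc (r + u)) ⇔ (v ≡ suc u)
+-consecutive r {u} = mk⇔ (λ e → ℕ.+-cancelˡ-≡ r _ _ (trans e (sym (ℕ.+-suc r u))))
                          (λ { refl → ℕ.+-suc r u })

Joined-shift : ∀ r B x y → Joined (shift r B) x y ⇔ Joined B (r + x) (r + y)
Joined-shift r B x y = mk⇔ to from
  where
  to : Joined (shift r B) x y → Joined B (r + x) (r + y)
  to (up refl ¬b)   = up (ℕ.+-suc r x) ¬b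
  to (down refl ¬b) = down (ℕ.+-suc r y) ¬b
  from : Joined B (r + x) (r + y) → Joined (shift r B) x y
  from (up e ¬b)   with refl ← Equivalence.to (+-consecutive r) e = up refl ¬b
  from (down e ¬b) with refl ← Equivalence.to (+-consecutive r) e = down refl ¬b

Joined-across : ∀ {r S B x y} → (0 < S → B r) → x < r → y < S → ¬ Joined B x (r + y)
Joined-across {r} {B = B} {y = zero} cutAt-r x<r 0<S (up _ ¬b) =
  ¬b (subst B (sym (ℕ.+-identityʳ r)) (cutAt-r 0<S))
Joined-across {r} {y = suc y} _ x<r _ (up e _) = ℕ.m+1+n≰m r (subst (_≤ r) (sym e) x<r)
Joined-across {r} {y = y} _ x<r _ (down e _) =
  ℕ.<⇒≱ x<r (subst (r ≤_) (sym e) (ℕ.m≤n⇒m≤1+n (ℕ.m≤m+n r y)))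

cut-split : ∀ r S B → (0 < S → B r) → (Cut r B ⊕ Cut S (shift r B)) ≃ Cut (r + S) B
cut-split r S B cutAt-r = ↔-sym +↔⊎ , λ
  { (inj₁ a) (inj₁ b) → subst₂ (λ u v → Joined B (toℕ a) (toℕ b) ⇔ Joined B u v)
                          (sym (toℕ-↑ˡ a S)) (sym (toℕ-↑ˡ b S)) ⇔.refl
  ; (inj₂ a) (inj₂ b) → subst₂ (λ u v → Joined (shift r B) (toℕ a) (toℕ b) ⇔ Joined B u v)
                          (sym (toℕ-↑ʳ r a)) (sym (toℕ-↑ʳ r b)) (Joined-shift r B (toℕ a) (toℕ b))
  ; (inj₁ a) (inj₂ b) → mk⇔ ⊥-elim λ j → Joined-across cutAt-r (toℕ<n a) (toℕ<n b)
                          (subst₂ (Joined B) (toℕ-↑ˡ a S) (toℕ-↑ʳ r b) j)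
  ; (inj₂ a) (inj₁ b) → mk⇔ ⊥-elim λ j → Joined-across cutAt-r (toℕ<n b) (toℕ<n a)
                          (Joined-sym (subst₂ (Joined B) (toℕ-↑ʳ r a) (toℕ-↑ˡ b S) j)) }

Paths-perm : ∀ {rs rs′} → rs ↭ rs′ → Paths rs ≃ Paths rs′
Paths-perm ↭.refl          = ≃-refl
Paths-perm (↭.prep r p)    = ⊕-cong ≃-refl (Paths-perm p)
Paths-perm (↭.swap r r′ p) =
  ≃-trans (≃-sym ⊕-assoc) (≃-trans (⊕-cong ⊕-comm (Paths-perm p)) ⊕-assoc)
Paths-perm (↭.trans p q)   = ≃-trans (Paths-perm p) (Paths-perm q)

record Composition (n : ℕ) : Set where
  constructor composition
  field
    parts    : List ℕ
    positive : All (0 <_) parts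
    sums     : sum parts ≡ n
open Composition public

decompose-run : ∀ r m (B : ℕ → Set) → Decidable B → 0 < r → (∀ x → suc x < r → ¬ B (suc x)) →
  Σ (Composition (r + m)) λ c → Cut (r + m) B ≃ Paths (parts c)
decompose-run r zero B B? 0<r uncut =
  composition (r ∷ []) (0<r ∷ []) refl ,
  ≃-trans (≃-sym (cut-split r 0 B λ ())) (⊕-cong (uncut⇒path uncut) (uncut⇒path λ _ ()))
decompose-run r (suc m) B B? 0<r uncut with B? r
... | yes cutAt-r =
  let (c , iso) = decompose-run 1 m (shift r B) (λ j → B? (r + j)) (s≤s z≤n) (λ { _ (s≤s ()) })
  in composition (r ∷ parts c) (0<r ∷ positive c) (cong (r +_) (sums c)) ,
     ≃-trans (≃-sym (cut-split r (suc m) B λ _ → cutAt-r)) (⊕-cong (uncut⇒path uncut) iso)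
... | no ¬cutAt-r =
  subst (λ k → Σ (Composition k) λ c → Cut k B ≃ Paths (parts c)) (sym (ℕ.+-suc r m))
        (decompose-run (suc r) m B B? (s≤s z≤n) uncut′)
  where
  uncut′ : ∀ x → suc x < suc r → ¬ B (suc x)
  uncut′ x (s≤s le) with ℕ.m≤n⇒m<n∨m≡n le
  ... | inj₁ lt   = uncut x lt
  ... | inj₂ refl = ¬cutAt-r

decompose : ∀ n (B : ℕ → Set) → Decidable B → Σ (Composition n) λ c → Cut n B ≃ Paths (parts c)
decompose zero    B B? = composition [] [] refl , uncut⇒path λ _ ()
decompose (suc m) B B? = decompose-run 1 m B B? (s≤s z≤n) λ { _ (s≤s ()) }

data Precedes {A : Set} : List A → A → A → Set where
  here  : ∀ {a b xs} → b ∈ xs → Precedes (a ∷ xs) a b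
  there : ∀ {a b x xs} → Precedes xs a b → Precedes (x ∷ xs) a b

module _ {A : Set} where

  lookup-injective : ∀ {xs : List A} → Unique xs → ∀ {i j} → lookup xs i ≡ lookup xs j → i ≡ j
  lookup-injective {_ ∷ _}  _           {zero}  {zero}  _ = refl
  lookup-injective {_ ∷ _}  (x≢ ∷ _)    {zero}  {suc j} e = ⊥-elim (All.lookup x≢ (∈-lookup j) e)
  lookup-injective {_ ∷ _}  (x≢ ∷ _)    {suc i} {zero}  e = ⊥-elim (All.lookup x≢ (∈-lookup i) (sym e))
  lookup-injective {_ ∷ _}  (_ ∷ uniq)  {suc i} {suc j} e = cong suc (lookup-injective uniq e)

  lookup↔ : ∀ {xs : List A} → Unique xs → (∀ a → a ∈ xs) → Fin (length xs) ↔ A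
  lookup↔ {xs} uniq complete = mk↔ₛ′ (lookup xs) (λ a → index (complete a))
    (λ a → sym (lookup-index (complete a)))
    (λ i → lookup-injective uniq (sym (lookup-index (complete (lookup xs i)))))

  precedes? : DecidableEquality A → ∀ xs a b → Dec (Precedes xs a b)
  precedes? _≟A_ []       a b = no λ ()
  precedes? _≟A_ (x ∷ xs) a b =
    map′ inject project ((x ≟A a ×-dec Any.any? (b ≟A_) xs) ⊎-dec precedes? _≟A_ xs a b)
    where
    inject : (x ≡ a × b ∈ xs) ⊎ Precedes xs a b → Precedes (x ∷ xs) a b
    inject (inj₁ (refl , b∈xs)) = here b∈xs
    inject (inj₂ p)             = there p
    project : Precedes (x ∷ xs) a b → (x ≡ a × b ∈ xs) ⊎ Precedes xs a b
    project (here b∈xs) = inj₁ (refl , b∈xs)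
    project (there p)   = inj₂ p

  Precedes⇒positions : ∀ {xs : List A} {a b} → Precedes xs a b →
    Σ (Fin (length xs)) λ i → Σ (Fin (length xs)) λ j →
      i <ᶠ j × lookup xs i ≡ a × lookup xs j ≡ b
  Precedes⇒positions (here b∈xs) =
    zero , suc (index b∈xs) , s≤s z≤n , refl , sym (lookup-index b∈xs)
  Precedes⇒positions (there p) with Precedes⇒positions p
  ... | i , j , i<j , ea , eb = suc i , suc j , s≤s i<j , ea , eb

  positions⇒Precedes : ∀ (xs : List A) {i j} → i <ᶠ j → Precedes xs (lookup xs i) (lookup xs j)
  positions⇒Precedes (x ∷ xs) {zero}  {suc j} _         = here (∈-lookup j)
  positions⇒Precedes (x ∷ xs) {suc i} {suc j} (s≤s i<j) = there (positions⇒Precedes xs i<j)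

  precedes⇒< : ∀ {xs : List A} → Unique xs → ∀ {i j} → Precedes xs (lookup xs i) (lookup xs j) → i <ᶠ j
  precedes⇒< uniq p with Precedes⇒positions p
  ... | _ , _ , i<j , ea , eb
    rewrite lookup-injective uniq ea | lookup-injective uniq eb = i<j

  Precedes⇒∈ : ∀ {xs : List A} {a b} → Precedes xs a b → a ∈ xs
  Precedes⇒∈ (here _)  = here refl
  Precedes⇒∈ (there p) = there (Precedes⇒∈ p)

  Precedes-AllPairs : ∀ {R : A → A → Set} {xs : List A} {a b} → AllPairs R xs → Precedes xs a b → R a b
  Precedes-AllPairs (a-R ∷ _) (here b∈xs) = All.lookup a-R b∈xs
  Precedes-AllPairs (_ ∷ rs)  (there p)   = Precedes-AllPairs rs p

  Precedes-map⁺ : ∀ {B : Set} (f : A → B) {xs a b} → Precedes xs a b → Precedes (map f xs) (f a) (f b)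
  Precedes-map⁺ f (here b∈xs) = here (∈-map⁺ f b∈xs)
  Precedes-map⁺ f (there p)   = there (Precedes-map⁺ f p)

  Precedes-map⁻ : ∀ {B : Set} (f : A → B) {xs u v} → Precedes (map f xs) u v →
    Σ A λ a → Σ A λ b → u ≡ f a × v ≡ f b × Precedes xs a b
  Precedes-map⁻ f {x ∷ xs} (here v∈) with ∈-map⁻ f v∈
  ... | b , b∈xs , refl = x , b , refl , refl , here b∈xs
  Precedes-map⁻ f {x ∷ xs} (there p) with Precedes-map⁻ f p
  ... | a , b , ea , eb , q = a , b , ea , eb , there q

  Precedes-++⁻ : ∀ (xs : List A) {ys a b} → Precedes (xs ++ ys) a b →
    Precedes xs a b ⊎ (a ∈ xs × b ∈ ys) ⊎ Precedes ys a b
  Precedes-++⁻ []       p = inj₂ (inj₂ p)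
  Precedes-++⁻ (x ∷ xs) (here b∈) with ∈-++⁻ xs b∈
  ... | inj₁ b∈xs = inj₁ (here b∈xs)
  ... | inj₂ b∈ys = inj₂ (inj₁ (here refl , b∈ys))
  Precedes-++⁻ (x ∷ xs) (there p) with Precedes-++⁻ xs p
  ... | inj₁ q               = inj₁ (there q)
  ... | inj₂ (inj₁ (a∈ , b∈)) = inj₂ (inj₁ (there a∈ , b∈))
  ... | inj₂ (inj₂ q)        = inj₂ (inj₂ q)

  Precedes-++ˡ : ∀ {xs} (ys : List A) {a b} → Precedes xs a b → Precedes (xs ++ ys) a b
  Precedes-++ˡ ys (here b∈xs) = here (∈-++⁺ˡ b∈xs)
  Precedes-++ˡ ys (there p)   = there (Precedes-++ˡ ys p)

  Precedes-++ : ∀ {xs ys : List A} {a b} → a ∈ xs → b ∈ ys → Precedes (xs ++ ys) a b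
  Precedes-++ {x ∷ xs} (here refl) b∈ys = here (∈-++⁺ʳ xs b∈ys)
  Precedes-++ {x ∷ xs} (there a∈)  b∈ys = there (Precedes-++ a∈ b∈ys)

module _ {s : ℕ} where

  occ-∉ : ∀ {a : Fin s} w → a ∉ w → occ a w ≡ 0
  occ-∉ []                 _   = refl
  occ-∉ {a} (x ∷ w) a∉ with a ≟ x
  ... | yes a≡x = ⊥-elim (a∉ (here a≡x))
  ... | no  _   = occ-∉ w (λ a∈ → a∉ (there a∈))

  occ-head : ∀ (x : Fin s) w → occ x (x ∷ w) ≡ suc (occ x w)
  occ-head x w with x ≟ x
  ... | yes _   = refl
  ... | no  x≢x = ⊥-elim (x≢x refl)

  occ-tail : ∀ (a x : Fin s) w → occ a w ≤ occ a (x ∷ w)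
  occ-tail a x w with a ≟ x
  ... | yes _ = ℕ.n≤1+n _
  ... | no  _ = ℕ.≤-refl

  occ>0⇒∈ : ∀ {a : Fin s} w → 0 < occ a w → a ∈ w
  occ>0⇒∈ {a} (x ∷ w) pos with a ≟ x
  ... | yes a≡x = here a≡x
  ... | no  _   = there (occ>0⇒∈ w pos)

  ∈⇒occ>0 : ∀ {a : Fin s} w → a ∈ w → 0 < occ a w
  ∈⇒occ>0 {a} (x ∷ w) a∈ with a ≟ x | a∈
  ... | yes _   | _         = s≤s z≤n
  ... | no  a≢x | here a≡x  = ⊥-elim (a≢x a≡x)
  ... | no  _   | there a∈w = ∈⇒occ>0 w a∈w

  at-most-once⇒unique : ∀ (w : Word s) → (∀ a → occ a w ≤ 1) → Unique w
  at-most-once⇒unique []      _    = []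
  at-most-once⇒unique (x ∷ w) once =
    ¬Any⇒All¬ w x∉w ∷ at-most-once⇒unique w (λ a → ℕ.≤-trans (occ-tail a x w) (once a))
    where
    x∉w : x ∉ w
    x∉w x∈w with ℕ.≤-trans (ℕ.≤-reflexive (sym (occ-head x w))) (once x)
    ... | s≤s occ≤0 = ℕ.<⇒≱ (∈⇒occ>0 w x∈w) occ≤0

  unique⇒at-most-once : ∀ {w : Word s} → Unique w → ∀ a → a ∈ w → occ a w ≡ 1
  unique⇒at-most-once {x ∷ w} uniq a a∈ with a ≟ x | a∈
  ... | yes refl | _         = cong suc (occ-∉ w (Unique.Unique[x∷xs]⇒x∉xs uniq))
  ... | no  a≢x  | here a≡x  = ⊥-elim (a≢x a≡x)
  ... | no  _    | there a∈w with uniq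
  ...   | _ ∷ uniq′ = unique⇒at-most-once uniq′ a a∈w

  slender⇔ : ∀ (w : Word s) → IsSlender w ⇔ (Unique w × ∀ a → a ∈ w)
  slender⇔ w = mk⇔
    (λ sl → at-most-once⇒unique w (λ a → ℕ.≤-reflexive (sl a)) ,
            (λ a → occ>0⇒∈ w (ℕ.≤-reflexive (sym (sl a)))))
    (λ (uniq , complete) a → unique⇒at-most-once uniq a (complete a))

  Descent : Word s → ℕ → Set
  Descent w j = Σ (Fin s) λ a → Σ (Fin s) λ b → NextLetter a b × toℕ b ≡ j × Precedes w b a

  descent? : ∀ w j → Dec (Descent w j)
  descent? w j = any? λ a → any? λ b →
    (toℕ b ℕ.≟ suc (toℕ a)) ×-dec (toℕ b ℕ.≟ j) ×-dec precedes? _≟_ w b a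

  module _ {w : Word s} (uniq : Unique w) where

    ordered⇔no-descent : ∀ {i j} → NextLetter (lookup w i) (lookup w j) →
      i <ᶠ j ⇔ (¬ Descent w (toℕ (lookup w j)))
    ordered⇔no-descent {i} {j} next = mk⇔ to from
      where
      to : i <ᶠ j → ¬ Descent w (toℕ (lookup w j))
      to i<j (a , b , next′ , eb , b-first)
        with refl ← toℕ-injective eb
        with refl ← toℕ-injective (ℕ.suc-injective (trans (sym next′) next))
        = ℕ.<-asym i<j (precedes⇒< uniq b-first)
      from : ¬ Descent w (toℕ (lookup w j)) → i <ᶠ j
      from no-descent with <-cmp i j
      ... | tri< i<j _ _ = i<j
      ... | tri≈ _ refl _ = ⊥-elim (ℕ.1+n≢n (sym next))
      ... | tri> _ _ j<i = ⊥-elim (no-descent (_ , _ , next , refl , positions⇒Precedes w j<i))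

    parikh≃cut : (∀ a → a ∈ w) → asVGraph (ParikhGraph w) ≃ Cut s (Descent w)
    parikh≃cut complete = lookup↔ uniq complete , λ i j → mk⇔ to from
      where
      to : ∀ {i j} → ParikhAdj w i j → Joined (Descent w) (toℕ (lookup w i)) (toℕ (lookup w j))
      to (inj₁ (i<j , next)) = up next (Equivalence.to (ordered⇔no-descent next) i<j)
      to (inj₂ (j<i , next)) = down next (Equivalence.to (ordered⇔no-descent next) j<i)
      from : ∀ {i j} → Joined (Descent w) (toℕ (lookup w i)) (toℕ (lookup w j)) → ParikhAdj w i j
      from (up next ¬d)   = inj₁ (Equivalence.from (ordered⇔no-descent next) ¬d , next)
      from (down next ¬d) = inj₂ (Equivalence.from (ordered⇔no-descent next) ¬d , next)

ascending : (r : ℕ) → List (Fin r)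
ascending zero    = []
ascending (suc r) = zero ∷ map suc (ascending r)

ascending-complete : ∀ {r} (a : Fin r) → a ∈ ascending r
ascending-complete zero    = here refl
ascending-complete (suc a) = there (∈-map⁺ suc (ascending-complete a))

ascending-increasing : ∀ r → AllPairs _<ᶠ_ (ascending r)
ascending-increasing zero    = []
ascending-increasing (suc r) =
  All.map⁺ (All.universal (λ _ → s≤s z≤n) (ascending r)) ∷
  AllPairs.map⁺ (AllPairs.map s≤s (ascending-increasing r))

canonical : (rs : List ℕ) → Word (sum rs)
canonical []       = []
canonical (r ∷ rs) = map (r ↑ʳ_) (canonical rs) ++ map (_↑ˡ sum rs) (ascending r)

module Blocks (r : ℕ) (rs : List ℕ) where

  S : ℕ
  S = sum rs

  front : Word (r + S)
  front = map (r ↑ʳ_) (canonical rs)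

  back : Word (r + S)
  back = map (_↑ˡ S) (ascending r)

  front-large : ∀ {v} → v ∈ front → r ≤ toℕ v
  front-large v∈ with ∈-map⁻ (r ↑ʳ_) v∈
  ... | b , _ , refl = ℕ.≤-trans (ℕ.m≤m+n r (toℕ b)) (ℕ.≤-reflexive (sym (toℕ-↑ʳ r b)))

  small-not-in-front : ∀ {v} → toℕ v < r → ¬ v ∈ front
  small-not-in-front v<r v∈ = ℕ.<⇒≱ v<r (front-large v∈)

  back-small : ∀ {v} → v ∈ back → toℕ v < r
  back-small v∈ with ∈-map⁻ (_↑ˡ S) v∈
  ... | a , _ , refl = subst (_< r) (sym (toℕ-↑ˡ a S)) (toℕ<n a)

canonical-unique : ∀ rs → Unique (canonical rs)
canonical-unique []       = []
canonical-unique (r ∷ rs) = Unique.++⁺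
  (Unique.map⁺ (↑ʳ-injective r _ _) (canonical-unique rs))
  (Unique.map⁺ (↑ˡ-injective (sum rs) _ _) (AllPairs.map <⇒≢ (ascending-increasing r)))
  λ (v∈front , v∈back) → small-not-in-front (back-small v∈back) v∈front
  where open Blocks r rs

canonical-complete : ∀ rs (c : Fin (sum rs)) → c ∈ canonical rs
canonical-complete (r ∷ rs) c =
  subst (_∈ canonical (r ∷ rs)) (join-splitAt r (sum rs) c) (from-split (splitAt r c))
  where
  from-split : ∀ (x : Fin r ⊎ Fin (sum rs)) → join r (sum rs) x ∈ canonical (r ∷ rs)
  from-split (inj₁ a) = ∈-++⁺ʳ (Blocks.front r rs) (∈-map⁺ (_↑ˡ sum rs) (ascending-complete a))
  from-split (inj₂ b) = ∈-++⁺ˡ (∈-map⁺ (r ↑ʳ_) (canonical-complete rs b))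

module CanonicalDescents (r : ℕ) (rs : List ℕ) where
  open Blocks r rs

  no-descent-in-first-block : ∀ x → suc x < r → ¬ Descent (canonical (r ∷ rs)) (suc x)
  no-descent-in-first-block x sx<r (a , b , next , eb , b-first) with Precedes-++⁻ front b-first
  ... | inj₁ p               = small-not-in-front (subst (_< r) (sym eb) sx<r) (Precedes⇒∈ p)
  ... | inj₂ (inj₁ (b∈ , _)) = small-not-in-front (subst (_< r) (sym eb) sx<r) b∈
  ... | inj₂ (inj₂ p) with Precedes-map⁻ (_↑ˡ S) p
  ...   | b′ , a′ , refl , refl , b′-first =
    ℕ.<-asym (Precedes-AllPairs (ascending-increasing r) b′-first) (ℕ.≤-reflexive (sym next′))
    where
    next′ : NextLetter a′ b′
    next′ = trans (sym (toℕ-↑ˡ b′ S)) (trans next (cong suc (toℕ-↑ˡ a′ S)))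

  descent-between-blocks : (last : Fin r) → suc (toℕ last) ≡ r → 0 < S → Descent (canonical (r ∷ rs)) r
  descent-between-blocks last last+1≡r 0<S = last ↑ˡ S , r ↑ʳ first , next , r-first ,
      Precedes-++ (∈-map⁺ (r ↑ʳ_) (canonical-complete rs first))
                  (∈-map⁺ (_↑ˡ S) (ascending-complete last))
    where
    open ≡-Reasoning
    first : Fin S
    first = fromℕ< 0<S
    r-first : toℕ (r ↑ʳ first) ≡ r
    r-first = begin
      toℕ (r ↑ʳ first)  ≡⟨ toℕ-↑ʳ r first ⟩
      r + toℕ first     ≡⟨ cong (r +_) (toℕ-fromℕ< 0<S) ⟩
      r + 0             ≡⟨ ℕ.+-identityʳ r ⟩
      r                 ∎
    next : NextLetter (last ↑ˡ S) (r ↑ʳ first)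
    next = begin
      toℕ (r ↑ʳ first)    ≡⟨ r-first ⟩
      r                   ≡⟨ sym last+1≡r ⟩
      suc (toℕ last)      ≡⟨ cong suc (sym (toℕ-↑ˡ last S)) ⟩
      suc (toℕ (last ↑ˡ S)) ∎

  descent-shift : ∀ x → Descent (canonical (r ∷ rs)) (r + suc x) ⇔ Descent (canonical rs) (suc x)
  descent-shift x = mk⇔ to from
    where
    next-↑ʳ : ∀ {a b} → (toℕ (r ↑ʳ b) ≡ suc (toℕ (r ↑ʳ a))) ⇔ (toℕ b ≡ suc (toℕ a))
    next-↑ʳ {a} {b} rewrite toℕ-↑ʳ r a | toℕ-↑ʳ r b = +-consecutive r
    large : ∀ {v} → toℕ v ≡ r + suc x → ¬ toℕ v ≤ r
    large {v} ev v≤r = ℕ.m+1+n≰m r (subst (_≤ r) ev v≤r)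
    to : Descent (canonical (r ∷ rs)) (r + suc x) → Descent (canonical rs) (suc x)
    to (a , b , next , eb , b-first) with Precedes-++⁻ front b-first
    ... | inj₁ p with Precedes-map⁻ (r ↑ʳ_) p
    ...   | b′ , a′ , refl , refl , b′-first =
      a′ , b′ , Equivalence.to next-↑ʳ next ,
      ℕ.+-cancelˡ-≡ r _ _ (trans (sym (toℕ-↑ʳ r b′)) eb) , b′-first
    to (a , b , next , eb , b-first) | inj₂ (inj₁ (_ , a∈back)) =
      ⊥-elim (large eb (subst (_≤ r) (sym next) (back-small a∈back)))
    to (a , b , next , eb , b-first) | inj₂ (inj₂ p) = ⊥-elim (large eb (ℕ.<⇒≤ (back-small (Precedes⇒∈ p))))
    from : Descent (canonical rs) (suc x) → Descent (canonical (r ∷ rs)) (r + suc x)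
    from (a′ , b′ , next′ , eb′ , b′-first) =
      r ↑ʳ a′ , r ↑ʳ b′ , Equivalence.from next-↑ʳ next′ ,
      trans (toℕ-↑ʳ r b′) (cong (r +_) eb′) , Precedes-++ˡ back (Precedes-map⁺ (r ↑ʳ_) b′-first)

canonical-slender : ∀ rs → IsSlender (canonical rs)
canonical-slender rs =
  Equivalence.from (slender⇔ (canonical rs)) (canonical-unique rs , canonical-complete rs)

canonical-graph : ∀ rs → All (0 <_) rs → Cut (sum rs) (Descent (canonical rs)) ≃ Paths rs
canonical-graph []             []          = uncut⇒path λ _ ()
canonical-graph (suc r₀ ∷ rs) (_ ∷ pos) =
  ≃-trans (≃-sym (cut-split r (sum rs) _ (descent-between-blocks (fromℕ r₀) (cong suc (toℕ-fromℕ r₀)))))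
          (⊕-cong (uncut⇒path no-descent-in-first-block)
                  (≃-trans (cut-cong λ x _ → descent-shift x) (canonical-graph rs pos)))
  where
  r : ℕ
  r = suc r₀
  open CanonicalDescents r rs

Reach : (G : VGraph) → Vertex G → Vertex G → Set
Reach G = Star (Edge G)

reach-transport : ∀ {G H} (φ : G ≃ H) {x y} →
  Reach G x y ⇔ Reach H (Inverse.to (_≃_.bij φ) x) (Inverse.to (_≃_.bij φ) y)
reach-transport {G} {H} φ {x} {y} = mk⇔ (forward φ) backward
  where
  forward : ∀ {G H} (ψ : G ≃ H) {u v} →
    Reach G u v → Reach H (Inverse.to (_≃_.bij ψ) u) (Inverse.to (_≃_.bij ψ) v)
  forward (f , edges) = gmap (Inverse.to f) (λ {u} {v} → Equivalence.to (edges u v))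
  backward : Reach H (Inverse.to (_≃_.bij φ) x) (Inverse.to (_≃_.bij φ) y) → Reach G x y
  backward p = subst₂ (Reach G) (Inverse.strictlyInverseʳ (_≃_.bij φ) x)
                                (Inverse.strictlyInverseʳ (_≃_.bij φ) y) (forward (≃-sym φ) p)

-- A path is connected: walk down to the vertex 0 and back up.
path-connected : ∀ n (x y : Fin n) → Reach (Path n) x y
path-connected (suc n) x y = to-origin x refl ◅◅ reverse Joined-sym (to-origin y refl)
  where
  to-origin : ∀ {k} (v : Fin (suc n)) → toℕ v ≡ k → Reach (Path (suc n)) v zero
  to-origin {zero}  v ev = subst (λ u → Reach (Path (suc n)) u zero) (sym (toℕ-injective ev)) ε
  to-origin {suc k} v ev =
    down (trans ev (cong suc (sym (toℕ-fromℕ< k<n)))) (λ ()) ◅ to-origin (fromℕ< k<n) (toℕ-fromℕ< k<n)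
    where
    k<n : k < suc n
    k<n = ℕ.<-trans (ℕ.n<1+n k) (subst (_< suc n) ev (toℕ<n v))

no-crossingˡ : ∀ {G H x y} → ¬ Reach (G ⊕ H) (inj₁ x) (inj₂ y)
no-crossingˡ (_◅_ {j = inj₁ _} _ walk) = no-crossingˡ walk

no-crossingʳ : ∀ {G H x y} → ¬ Reach (G ⊕ H) (inj₂ x) (inj₁ y)
no-crossingʳ (_◅_ {j = inj₂ _} _ walk) = no-crossingʳ walk

reach-⊕ʳ : ∀ {G H x y} → Reach (G ⊕ H) (inj₂ x) (inj₂ y) → Reach H x y
reach-⊕ʳ ε                         = ε
reach-⊕ʳ (_◅_ {j = inj₂ _} e walk) = e ◅ reach-⊕ʳ walk

reach? : ∀ rs (u v : Vertex (Paths rs)) → Dec (Reach (Paths rs) u v)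
reach? (r ∷ rs) (inj₁ a) (inj₁ b) = yes (gmap inj₁ (λ e → e) (path-connected r a b))
reach? (r ∷ rs) (inj₁ a) (inj₂ y) = no no-crossingˡ
reach? (r ∷ rs) (inj₂ x) (inj₁ b) = no no-crossingʳ
reach? (r ∷ rs) (inj₂ x) (inj₂ y) = map′ (gmap inj₂ (λ e → e)) reach-⊕ʳ (reach? rs x y)

total : ∀ rs → (Vertex (Paths rs) → ℕ) → ℕ
total []       g = 0
total (r ∷ rs) g = ∑ (g ∘ inj₁) + total rs (g ∘ inj₂)

∑-split : ∀ r {S} (h : Fin (r + S) → ℕ) → ∑ h ≡ ∑ (h ∘ (_↑ˡ S)) + ∑ (h ∘ (r ↑ʳ_))
∑-split zero    h = refl
∑-split (suc r) h = trans (cong (h zero +_) (∑-split r (h ∘ suc))) (sym (ℕ.+-assoc (h zero) _ _))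

∑-const : ∀ n c → ∑ {n} (λ _ → c) ≡ n * c
∑-const zero    c = refl
∑-const (suc n) c = cong (c +_) (∑-const n c)

numbering : ∀ rs → Vertex (Paths rs) ↔ Fin (sum rs)
numbering []       = ↔-refl
numbering (r ∷ rs) = ↔-trans (↔-refl ⊎-↔ numbering rs) (↔-sym +↔⊎)

total-numbering : ∀ rs g → total rs g ≡ ∑ (g ∘ Inverse.from (numbering rs))
total-numbering []       g = refl
total-numbering (r ∷ rs) g = sym (begin
  ∑ (g ∘ from (numbering (r ∷ rs)))
    ≡⟨ ∑-split r _ ⟩
  ∑ (λ a → g (from (numbering (r ∷ rs)) (a ↑ˡ sum rs))) + ∑ (λ b → g (from (numbering (r ∷ rs)) (r ↑ʳ b)))
    ≡⟨ cong₂ _+_ (sum-cong-≗ λ a → cong (g ∘ unsplit) (splitAt-↑ˡ r a (sum rs)))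
                 (sum-cong-≗ λ b → cong (g ∘ unsplit) (splitAt-↑ʳ r (sum rs) b)) ⟩
  ∑ (g ∘ inj₁) + ∑ (g ∘ inj₂ ∘ from (numbering rs))
    ≡⟨ cong (∑ (g ∘ inj₁) +_) (sym (total-numbering rs (g ∘ inj₂))) ⟩
  total (r ∷ rs) g ∎)
  where
  open ≡-Reasoning
  open Inverse using (from)
  unsplit : Fin r ⊎ Fin (sum rs) → Vertex (Paths (r ∷ rs))
  unsplit = from (↔-refl ⊎-↔ numbering rs)

total-transport : ∀ {rs rs′} (φ : Paths rs ≃ Paths rs′) {g g′} →
  (∀ v → g′ (Inverse.to (_≃_.bij φ) v) ≡ g v) → total rs g ≡ total rs′ g′
total-transport {rs} {rs′} (f , _) {g} {g′} g′∘f≗g = begin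
  total rs g                                     ≡⟨ total-numbering rs g ⟩
  ∑ (g ∘ from (numbering rs))                    ≡⟨ sum-permute _ π ⟩
  ∑ (g ∘ from (numbering rs) ∘ Inverse.to π)     ≡⟨ sum-cong-≗ relabel ⟩
  ∑ (g′ ∘ from (numbering rs′))                  ≡⟨ total-numbering rs′ g′ ⟨
  total rs′ g′                                   ∎
  where
  open ≡-Reasoning
  open Inverse using (from)
  π : Fin (sum rs′) ↔ Fin (sum rs)
  π = ↔-trans (↔-sym (numbering rs′)) (↔-trans (↔-sym f) (numbering rs))
  relabel : ∀ i → g (from (numbering rs) (Inverse.to π i)) ≡ g′ (from (numbering rs′) i)
  relabel i = begin
    g (from (numbering rs) (Inverse.to π i))  ≡⟨ cong g (Inverse.strictlyInverseʳ (numbering rs) _) ⟩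
    g (from f (from (numbering rs′) i))       ≡⟨ g′∘f≗g _ ⟨
    g′ (Inverse.to f (from f (from (numbering rs′) i)))
                                              ≡⟨ cong g′ (Inverse.strictlyInverseˡ f _) ⟩
    g′ (from (numbering rs′) i)               ∎

total-cong : ∀ rs {g g′ : Vertex (Paths rs) → ℕ} → (∀ v → g v ≡ g′ v) → total rs g ≡ total rs g′
total-cong rs g≗g′ = total-transport {rs} ≃-refl (λ v → sym (g≗g′ v))

total-zero : ∀ rs → total rs (λ _ → 0) ≡ 0
total-zero []       = refl
total-zero (r ∷ rs) = cong₂ _+_ (trans (∑-const r 0) (ℕ.*-zeroʳ r)) (total-zero rs)

indicator : ∀ {P : Set} → Dec P → ℕ
indicator p? = if does p? then 1 else 0

indicator-yes : ∀ {P : Set} → P → (p? : Dec P) → indicator p? ≡ 1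
indicator-yes p (yes _) = refl
indicator-yes p (no ¬p) = ⊥-elim (¬p p)

indicator-no : ∀ {P : Set} → ¬ P → (p? : Dec P) → indicator p? ≡ 0
indicator-no ¬p (yes p) = ⊥-elim (¬p p)
indicator-no ¬p (no _)  = refl

indicator-cong : ∀ {P Q : Set} → P ⇔ Q → (p? : Dec P) (q? : Dec Q) → indicator p? ≡ indicator q?
indicator-cong P⇔Q (yes _) (yes _) = refl
indicator-cong P⇔Q (yes p) (no ¬q) = ⊥-elim (¬q (Equivalence.to P⇔Q p))
indicator-cong P⇔Q (no ¬p) (yes q) = ⊥-elim (¬p (Equivalence.from P⇔Q q))
indicator-cong P⇔Q (no _)  (no _)  = refl

componentSize : ∀ rs → Vertex (Paths rs) → ℕ
componentSize rs v = total rs (λ u → indicator (reach? rs v u))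

componentSize-transport : ∀ {rs rs′} (φ : Paths rs ≃ Paths rs′) v →
  componentSize rs v ≡ componentSize rs′ (Inverse.to (_≃_.bij φ) v)
componentSize-transport {rs} {rs′} φ v = total-transport φ λ u →
  indicator-cong (⇔.sym (reach-transport φ)) (reach? rs′ _ _) (reach? rs v u)

componentSize-head : ∀ r rs a → componentSize (r ∷ rs) (inj₁ a) ≡ r
componentSize-head r rs a = begin
  ∑ {r} (λ _ → 1) + total rs (λ _ → 0)  ≡⟨ cong₂ _+_ (∑-const r 1) (total-zero rs) ⟩
  r * 1 + 0                            ≡⟨ ℕ.+-identityʳ (r * 1) ⟩
  r * 1                                ≡⟨ ℕ.*-identityʳ r ⟩
  r                                    ∎
  where open ≡-Reasoning

componentSize-tail : ∀ r rs x → componentSize (r ∷ rs) (inj₂ x) ≡ componentSize rs x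
componentSize-tail r rs x =
  cong (_+ componentSize rs x) (trans (∑-const r 0) (ℕ.*-zeroʳ r))

Mass : List ℕ → ℕ → ℕ
Mass []       t = 0
Mass (r ∷ rs) t = r * indicator (r ℕ.≟ t) + Mass rs t

mass-components : ∀ rs t → total rs (λ v → indicator (componentSize rs v ℕ.≟ t)) ≡ Mass rs t
mass-components []       t = refl
mass-components (r ∷ rs) t = cong₂ _+_
  (trans (sum-cong-≗ λ a → cong [_≟t] (componentSize-head r rs a)) (∑-const r _))
  (trans (total-cong rs λ x → cong [_≟t] (componentSize-tail r rs x)) (mass-components rs t))
  where
  [_≟t] : ℕ → ℕ
  [ k ≟t] = indicator (k ℕ.≟ t)

Mass-invariant : ∀ {rs rs′} → Paths rs ≃ Paths rs′ → ∀ t → Mass rs t ≡ Mass rs′ t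
Mass-invariant {rs} {rs′} φ t = begin
  Mass rs t                                                   ≡⟨ mass-components rs t ⟨
  total rs (λ v → indicator (componentSize rs v ℕ.≟ t))       ≡⟨ total-transport φ same-size ⟩
  total rs′ (λ v → indicator (componentSize rs′ v ℕ.≟ t))     ≡⟨ mass-components rs′ t ⟩
  Mass rs′ t                                                  ∎
  where
  open ≡-Reasoning
  same-size : ∀ v → indicator (componentSize rs′ (Inverse.to (_≃_.bij φ) v) ℕ.≟ t)
                  ≡ indicator (componentSize rs v ℕ.≟ t)
  same-size v = cong (λ k → indicator (k ℕ.≟ t)) (sym (componentSize-transport φ v))

partition-≡ : ∀ {s} (p q : Partition s) → Partition.parts p ≡ Partition.parts q → p ≡ q
partition-≡ (partition l nonincr positive sums) (partition .l nonincr′ positive′ sums′) refl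
  with Linked.irrelevant ℕ.≤-irrelevant nonincr nonincr′
     | All.irrelevant ℕ.≤-irrelevant positive positive′
     | ℕ.≡-irrelevant sums sums′
... | refl | refl | refl = refl

toComposition : ∀ {s} → Partition s → Composition s
toComposition p = composition (Partition.parts p) (Partition.positive p) (Partition.sums p)

module Sorting = Data.List.Sort (Flip.decTotalOrder ℕ.≤-decTotalOrder)

sortComposition : ∀ {s} → Composition s → Partition s
sortComposition (composition rs positive sums) = partition (Sorting.sort rs) (Sorting.sort-↗ rs)
  (All-resp-↭ (↭-sym (Sorting.sort-↭ rs)) positive) (trans (sum-↭ (Sorting.sort-↭ rs)) sums)

sortComposition-↭ : ∀ {s} (c : Composition s) → parts c ↭ Partition.parts (sortComposition c)
sortComposition-↭ c = ↭-sym (Sorting.sort-↭ (parts c))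

Mass-below : ∀ {rs t} → All (_< t) rs → Mass rs t ≡ 0
Mass-below              []           = refl
Mass-below {r ∷ rs} {t} (r<t ∷ rs<t) = cong₂ _+_
  (trans (cong (r *_) (indicator-no (ℕ.<⇒≢ r<t) (r ℕ.≟ t))) (ℕ.*-zeroʳ r)) (Mass-below rs<t)

Mass-head : ∀ r rs → 0 < r → 0 < Mass (r ∷ rs) r
Mass-head r rs 0<r = ℕ.≤-trans 0<r (ℕ.≤-trans (ℕ.≤-reflexive r≡r*1) (ℕ.m≤m+n _ (Mass rs r)))
  where
  r≡r*1 : r ≡ r * indicator (r ℕ.≟ r)
  r≡r*1 = sym (trans (cong (r *_) (indicator-yes refl (r ℕ.≟ r))) (ℕ.*-identityʳ r))

all-below : ∀ {r rs t} → Linked _≥_ (r ∷ rs) → r < t → All (_< t) (r ∷ rs)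
all-below {rs = []}    _             r<t = r<t ∷ []
all-below {rs = _ ∷ _} (r≥x ∷ sorted) r<t =
  r<t ∷ All.map (λ x≤r → ℕ.≤-<-trans x≤r r<t) (Linked⇒All (λ p q → ℕ.≤-trans q p) r≥x sorted)

tail-sorted : ∀ {r rs} → Linked _≥_ (r ∷ rs) → Linked _≥_ rs
tail-sorted [-]          = []
tail-sorted (_ ∷ sorted) = sorted

-- A non-increasing list of positive numbers is determined by its mass function:
-- its largest part is the largest t with positive mass, and then induct.
Mass-injective : ∀ {rs rs′} → Linked _≥_ rs → Linked _≥_ rs′ → All (0 <_) rs → All (0 <_) rs′ →
  (∀ t → Mass rs t ≡ Mass rs′ t) → rs ≡ rs′
Mass-injective {[]}     {[]}       _ _ _ _ _ = refl
Mass-injective {[]}     {r′ ∷ rs′} _ _ _ (0<r′ ∷ _) same =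
  ⊥-elim (ℕ.<-irrefl (same r′) (Mass-head r′ rs′ 0<r′))
Mass-injective {r ∷ rs} {[]}       _ _ (0<r ∷ _) _ same =
  ⊥-elim (ℕ.<-irrefl (sym (same r)) (Mass-head r rs 0<r))
Mass-injective {r ∷ rs} {r′ ∷ rs′} sorted sorted′ (0<r ∷ pos) (0<r′ ∷ pos′) same
  with ℕ.<-cmp r r′
... | tri< r<r′ _ _ = ⊥-elim (ℕ.<-irrefl
        (trans (sym (Mass-below (all-below sorted r<r′))) (same r′)) (Mass-head r′ rs′ 0<r′))
... | tri> _ _ r′<r = ⊥-elim (ℕ.<-irrefl
        (trans (sym (Mass-below (all-below sorted′ r′<r))) (sym (same r))) (Mass-head r rs 0<r))
... | tri≈ _ refl _ = cong (r ∷_) (Mass-injective (tail-sorted sorted) (tail-sorted sorted′) pos pos′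
        λ t → ℕ.+-cancelˡ-≡ (r * indicator (r ℕ.≟ t)) _ _ (same t))

-- Finitely many partitions: every partition of s is found among the lists of
-- length ≤ s with entries ≤ s, so the partitions of s can be listed without repetition.
module _ (s : ℕ) where

  _≟ₚ_ : DecidableEquality (Partition s)
  p ≟ₚ q with List.≡-dec ℕ._≟_ (Partition.parts p) (Partition.parts q)
  ... | yes same = yes (partition-≡ p q same)
  ... | no  diff = no λ p≡q → diff (cong Partition.parts p≡q)

  IsPartition : List ℕ → Set
  IsPartition l = Linked _≥_ l × All (0 <_) l × sum l ≡ s

  isPartition? : ∀ l → Dec (IsPartition l)
  isPartition? l = Linked.linked? (λ x y → y ℕ.≤? x) l ×-dec All.all? (0 ℕ.<?_) l ×-dec (sum l ℕ.≟ s)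

  partitionsAmong : List (List ℕ) → List (Partition s)
  partitionsAmong []       = []
  partitionsAmong (l ∷ ls) with isPartition? l
  ... | yes (nonincr , positive , sums) = partition l nonincr positive sums ∷ partitionsAmong ls
  ... | no  _                           = partitionsAmong ls

  ∈-partitionsAmong : ∀ ls (p : Partition s) → Partition.parts p ∈ ls → p ∈ partitionsAmong ls
  ∈-partitionsAmong (l ∷ ls) p l∈ with isPartition? l | l∈
  ... | yes _ | here refl = here (partition-≡ p _ refl)
  ... | yes _ | there l∈ls = there (∈-partitionsAmong ls p l∈ls)
  ... | no ¬p | here refl = ⊥-elim (¬p (Partition.nonincr p , Partition.positive p , Partition.sums p))
  ... | no _  | there l∈ls = ∈-partitionsAmong ls p l∈ls

boundedLists : ℕ → ℕ → List (List ℕ)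
boundedLists m zero    = [] ∷ []
boundedLists m (suc L) = [] ∷ cartesianProductWith _∷_ (upTo (suc m)) (boundedLists m L)

∈-boundedLists : ∀ {m} L l → length l ≤ L → All (_≤ m) l → l ∈ boundedLists m L
∈-boundedLists zero    []      _         _             = here refl
∈-boundedLists (suc L) []      _         _             = here refl
∈-boundedLists (suc L) (x ∷ l) (s≤s len) (x≤m ∷ l≤m) =
  there (∈-cartesianProductWith⁺ _∷_ (∈-upTo⁺ (s≤s x≤m)) (∈-boundedLists L l len l≤m))

length≤sum : ∀ l → All (0 <_) l → length l ≤ sum l
length≤sum []      []             = z≤n
length≤sum (r ∷ l) (0<r ∷ pos) = ℕ.+-mono-≤ 0<r (length≤sum l pos)

part≤sum : ∀ l → All (_≤ sum l) l
part≤sum []      = []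
part≤sum (r ∷ l) = ℕ.m≤m+n r (sum l) ∷ All.map (λ x≤ → ℕ.≤-trans x≤ (ℕ.m≤n+m (sum l) r)) (part≤sum l)

partitions-finite : ∀ s → Σ ℕ λ k → Fin k ↔ Partition s
partitions-finite s = _ , lookup↔ (deduplicate-! (_≟ₚ_ s) candidates) complete
  where
  candidates : List (Partition s)
  candidates = partitionsAmong s (boundedLists s s)
  complete : ∀ p → p ∈ deduplicate (_≟ₚ_ s) candidates
  complete p@(partition l _ positive refl) = ∈-deduplicate⁺ (_≟ₚ_ s)
    (∈-partitionsAmong s (boundedLists s s) p (∈-boundedLists s l (length≤sum l positive) (part≤sum l)))

representative : ∀ {s} → Composition s → SlenderWord s
representative (composition rs _ refl) = canonical rs , canonical-slender rs

representative-graph : ∀ {s} (c : Composition s) →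
  asVGraph (ParikhGraph (proj₁ (representative c))) ≃ Paths (parts c)
representative-graph (composition rs positive refl) =
  ≃-trans (parikh≃cut (canonical-unique rs) (canonical-complete rs)) (canonical-graph rs positive)

classify : ∀ {s} (w : SlenderWord s) →
  Σ (Partition s) λ p → asVGraph (ParikhGraph (proj₁ w)) ≃ Paths (Partition.parts p)
classify {s} (w , slender) =
  let (unique , complete) = Equivalence.to (slender⇔ w) slender
      (c , runs)          = decompose s (Descent w) (descent? w)
  in sortComposition c ,
     ≃-trans (parikh≃cut unique complete) (≃-trans runs (Paths-perm (sortComposition-↭ c)))

paths-distinguish : ∀ {s} (p q : Partition s) → Paths (Partition.parts p) ≃ Paths (Partition.parts q) → p ≡ q
paths-distinguish p q φ = partition-≡ p q
  (Mass-injective (Partition.nonincr p) (Partition.nonincr q)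
                  (Partition.positive p) (Partition.positive q) (Mass-invariant φ))

theorem3p12 : (s : ℕ) → 2 ≤ s →
    Σ ℕ λ k →
      (Fin k ↔ Partition s)
      × Σ (Fin k → SlenderWord s) λ rep →
          ((i j : Fin k) →
             ParikhGraph (Σ.proj₁ (rep i)) ≅ ParikhGraph (Σ.proj₁ (rep j)) → i ≡ j)
          × ((w : SlenderWord s) →
               ∃ λ i → ParikhGraph (Σ.proj₁ w) ≅ ParikhGraph (Σ.proj₁ (rep i)))
theorem3p12 s _ = k , enum , rep , injective , surjective
  where
  k : ℕ
  k = proj₁ (partitions-finite s)
  enum : Fin k ↔ Partition s
  enum = proj₂ (partitions-finite s)
  part : Fin k → Partition s
  part = Inverse.to enum
  rep : Fin k → SlenderWord s
  rep i = representative (toComposition (part i))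
  graph-of : ∀ i → asVGraph (ParikhGraph (proj₁ (rep i))) ≃ Paths (Partition.parts (part i))
  graph-of i = representative-graph (toComposition (part i))
  injective : ∀ i j → ParikhGraph (proj₁ (rep i)) ≅ ParikhGraph (proj₁ (rep j)) → i ≡ j
  injective i j iso = Injection.injective (↔⇒↣ enum)
    (paths-distinguish (part i) (part j) (≃-trans (≃-sym (graph-of i)) (≃-trans (≅⇒≃ iso) (graph-of j))))
  surjective : ∀ w → ∃ λ i → ParikhGraph (proj₁ w) ≅ ParikhGraph (proj₁ (rep i))
  surjective w = i , ≃⇒≅ (≃-trans (proj₂ (classify w)) (≃-sym rep-i))
    where
    p : Partition s
    p = proj₁ (classify w)
    i : Fin k
    i = Inverse.from enum p
    rep-i : asVGraph (ParikhGraph (proj₁ (rep i))) ≃ Paths (Partition.parts p)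
    rep-i = subst (λ q → asVGraph (ParikhGraph (proj₁ (rep i))) ≃ Paths (Partition.parts q))
                  (Inverse.strictlyInverseˡ enum p) (graph-of i)
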